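{- Let $A$ and $B$ be stable matching instances on the same $n$ workers and $n$ firms such that $n-1$ of the workers have the same preference list in $A$ as in $B$, let $x$ be a feasible solution of the linear system $\sum_{f} x_{wf}=1$ for all $w$; $\sum_{w} x_{wf}=1$ for all $f$; $\sum_{f'<^I_w f} x_{wf'}-\sum_{w'>^I_f w} x_{w'f}\le 0$ for all $w,f$ and each $I\in\{A,B\}$; $x\ge 0$, and let $\theta\in[0,1]$ lie at no subinterval endpoint. Then the matching $\mu^A_\theta\,(=\mu^B_\theta)$ is stable under both $A$ and $B$, and the polyhedron defined by this linear system has integral vertices.
   Context: A perfect matching $M$ is stable under instance $I$ (each agent strictly totally ordering the other side) if no pair $(w,f)\notin M$ has $w$ preferring $f$ to $M(w)$ and $f$ preferring $w$ to $M(f)$ under $I$. In the constraint, $f'<^I_w f$ ranges over firms that $w$ ranks below $f$ in $I$, and $w'>^I_f w$ over workers that $f$ ranks above $w$ in $I$. Rounding: for instance $I$ and each worker $w$, split $[0,1]$ into consecutive subintervals of lengths $x_{wf}$ ordered by $w$'s $I$-preference from most to least preferred; $\mu^I_\theta(w)$ is the firm whose subinterval contains $\theta$.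
   Formalization: The feasible solution x has rational entries, θ is rational, and the polyhedron whose vertices are claimed integral consists only of its rational points. -}

module Defs where

open import Data.Nat using (ℕ; zero; suc)
open import Data.Fin using (Fin; zero; suc) renaming (_<_ to _<ᶠ_)
open import Data.Fin.Properties using () renaming (_<?_ to _<ᶠ?_)
open import Data.Integer using (ℤ)
open import Data.Rational using (ℚ; 0ℚ; 1ℚ; _+_; _-_; _*_; _≤_; _<_; _/_)
open import Data.Product using (Σ; ∃; _×_; _,_)
open import Data.Bool using (if_then_else_)
open import Function using (_∘_)
open import Function.Bundles using (_↔_; Inverse)
open import Relation.Nullary using (¬_; Dec)
open import Relation.Nullary.Decidable using (⌊_⌋)
open import Relation.Unary using (Pred)
open import Relation.Binary.PropositionalEquality using (_≡_; _≢_)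

sumᶠ : ∀ {k} → (Fin k → ℚ) → ℚ
sumᶠ {zero}  g = 0ℚ
sumᶠ {suc k} g = g zero + sumᶠ (g ∘ suc)

sumWhere : ∀ {k} (P : Fin k → Set) → (∀ i → Dec (P i)) → (Fin k → ℚ) → ℚ
sumWhere P P? g = sumᶠ (λ i → if ⌊ P? i ⌋ then g i else 0ℚ)

-- A stable matching instance on n workers and n firms (both indexed by Fin n).
-- Each agent's strict total order on the other side is given as a ranking
-- bijection: rank 0 = most preferred.
record Instance (n : ℕ) : Set where
  field
    wRankBij : Fin n → (Fin n ↔ Fin n)   -- worker w : firm ↦ rank
    fRankBij : Fin n → (Fin n ↔ Fin n)   -- firm f : worker ↦ rank

module _ {n : ℕ} (I : Instance n) where
  open Instance I

  wRank : Fin n → Fin n → Fin n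
  wRank w = Inverse.to (wRankBij w)

  fRank : Fin n → Fin n → Fin n
  fRank f = Inverse.to (fRankBij f)

  PrefW : Fin n → Fin n → Fin n → Set
  PrefW w f f' = wRank w f <ᶠ wRank w f'

  PrefF : Fin n → Fin n → Fin n → Set
  PrefF f w w' = fRank f w <ᶠ fRank f w'

  Stable : (Fin n → Fin n) → Set
  Stable M =
    (∀ w w' → M w ≡ M w' → w ≡ w') ×
    (∀ w f w' → M w ≢ f → M w' ≡ f → ¬ (PrefW w f (M w) × PrefF f w w'))

  -- Σ_{f' <^I_w f} x_{wf'} : firms f' that w ranks below f.
  belowSum : (Fin n → Fin n → ℚ) → Fin n → Fin n → ℚ
  belowSum x w f = sumWhere (λ f' → PrefW w f f') (λ f' → wRank w f <ᶠ? wRank w f') (x w)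

  -- Σ_{w' >^I_f w} x_{w'f} : workers w' that f ranks above w.
  aboveSum : (Fin n → Fin n → ℚ) → Fin n → Fin n → ℚ
  aboveSum x w f = sumWhere (λ w' → PrefF f w' w) (λ w' → fRank f w' <ᶠ? fRank f w) (λ w' → x w' f)

  -- Left endpoint of w's subinterval for firm f in the rounding under I:
  -- total weight of the firms w ranks strictly above f.
  lowEnd : (Fin n → Fin n → ℚ) → Fin n → Fin n → ℚ
  lowEnd x w f = sumWhere (λ f' → PrefW w f' f) (λ f' → wRank w f' <ᶠ? wRank w f) (x w)

  highEnd : (Fin n → Fin n → ℚ) → Fin n → Fin n → ℚ
  highEnd x w f = lowEnd x w f + x w f

  -- θ lies in w's (closed) subinterval for f, i.e. μ^I_θ(w) = f
  -- (for θ at no endpoint the containing subinterval is unique).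
  InSubinterval : (Fin n → Fin n → ℚ) → ℚ → Fin n → Fin n → Set
  InSubinterval x θ w f = lowEnd x w f ≤ θ × θ ≤ highEnd x w f

  NoEndpoint : (Fin n → Fin n → ℚ) → ℚ → Set
  NoEndpoint x θ = ∀ w f → (θ ≢ lowEnd x w f) × (θ ≢ highEnd x w f)

Feasible : ∀ {n} → Instance n → Instance n → (Fin n → Fin n → ℚ) → Set
Feasible A B x =
  (∀ w → sumᶠ (λ f → x w f) ≡ 1ℚ) ×
  (∀ f → sumᶠ (λ w → x w f) ≡ 1ℚ) ×
  (∀ w f → belowSum A x w f - aboveSum A x w f ≤ 0ℚ) ×
  (∀ w f → belowSum B x w f - aboveSum B x w f ≤ 0ℚ) ×
  (∀ w f → 0ℚ ≤ x w f)

IsVertex : ∀ {n} → Instance n → Instance n → (Fin n → Fin n → ℚ) → Set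
IsVertex {n} A B x =
  Feasible A B x ×
  (∀ (y z : Fin n → Fin n → ℚ) (λ' : ℚ) →
     Feasible A B y → Feasible A B z → 0ℚ < λ' → λ' < 1ℚ →
     (∀ w f → x w f ≡ λ' * y w f + (1ℚ - λ') * z w f) →
     ∀ w f → y w f ≡ z w f)

Integral : ∀ {n} → (Fin n → Fin n → ℚ) → Set
Integral x = ∀ w f → ∃ λ (k : ℤ) → x w f ≡ k / 1

SameList : ∀ {n} → Instance n → Instance n → Fin n → Set
SameList A B w = ∀ f → wRank A w f ≡ wRank B w f

-- Weighting each stability constraint of a feasible x by x_wf and counting the ordered pairs
-- of weights in every row and in every column shows that both weighted sums equal
-- (n - Σ x_wf²)/2; as every constraint holds, all those with x_wf > 0 are tight. A tight
-- constraint places w's subinterval for f at [1 - a - x_wf, 1 - a], a being the weight f gives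
-- to workers it prefers to w, so a firm stacks its subintervals in the reverse of its
-- preference order while a worker stacks them in its own order. A threshold θ interior to two
-- subintervals would thus have to lie in two disjoint intervals, which makes μ_θ a stable
-- matching. If A and B differ only at w₀, then μ^A_θ and μ^B_θ agree off w₀, hence everywhere
-- since both are injective.
--
-- For a vertex v, a θ below every positive endpoint rounds v to a matching μ with
-- v_{w,μ(w)} ≥ θ, and (v - θ P_μ)/(1 - θ) is again feasible; as v is θ P_μ plus (1 - θ) times
-- that point, extremality forces v = P_μ.

module Submission where

open import Defs
open import Data.Nat using (ℕ)
open import Data.Fin using (Fin)
open import Data.Rational using (ℚ; 0ℚ; 1ℚ; _≤_)
open import Data.Product using (∃; _×_)
open import Relation.Binary.PropositionalEquality using (_≢_)

open import Algebra.Bundles using (CommutativeRing)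
open import Data.Bool using (Bool; true; false; if_then_else_)
open import Data.Empty using (⊥; ⊥-elim)
open import Data.Fin using (zero; suc; toℕ; fromℕ<; punchOut) renaming (_<_ to _<ᶠ_)
open import Data.Fin.Properties
  using (any?; suc-injective; toℕ<n; toℕ-fromℕ<; toℕ-injective; injective⇒≤; punchOut-injective)
  renaming (_<?_ to _<ᶠ?_; _≟_ to _≟ᶠ_)
import Data.Fin.Properties as FP
import Data.Integer as ℤ
import Data.Nat as ℕ
import Data.Nat.Properties as ℕ
open import Data.Product using (_,_; proj₁; proj₂)
open import Data.Rational using (_+_; _*_; _-_; -_; _<_; _⊓_; 1/_; ½; NonZero; positive; nonNegative)
import Data.Rational.Properties as ℚ
open import Data.Rational.Solver using (module +-*-Solver)
open import Data.Sum using (inj₁; inj₂)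
open import Function using (_∘_; _↔_; Inverse; Injective; StrictlySurjective)
open import Function.Bundles using (Injection)
open import Function.Properties.Inverse using (↔⇒↣)
open import Relation.Binary.Definitions using (tri<; tri≈; tri>)
open import Relation.Binary.PropositionalEquality
  using (_≡_; refl; sym; trans; cong; cong₂; subst; subst₂; module ≡-Reasoning)
open import Relation.Nullary using (¬_; Dec; yes; no; contradiction)
open import Relation.Nullary.Decidable using (⌊_⌋)

open import Algebra.Properties.Group ℚ.+-0-group using (∙-cancelʳ; x∙y⁻¹≈ε⇒x≈y)
open import Algebra.Properties.Semiring.Sum (CommutativeRing.semiring ℚ.+-*-commutativeRing)
  using (sum; ∑-distrib-+; ∑-comm; *-distribˡ-sum)
open +-*-Solver

p≤q⇒p-q≤0 : ∀ {p q} → p ≤ q → p - q ≤ 0ℚ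
p≤q⇒p-q≤0 {p} {q} p≤q = subst (p - q ≤_) (ℚ.+-inverseʳ q) (ℚ.+-monoˡ-≤ (- q) p≤q)

p-q≤0⇒p≤q : ∀ {p q} → p - q ≤ 0ℚ → p ≤ q
p-q≤0⇒p≤q {p} {q} p-q≤0 = begin
  p            ≡⟨ solve 2 (λ p q → p := (p :- q) :+ q) refl p q ⟩
  (p - q) + q  ≤⟨ ℚ.+-monoˡ-≤ q p-q≤0 ⟩
  0ℚ + q       ≡⟨ ℚ.+-identityˡ q ⟩
  q            ∎
  where open ℚ.≤-Reasoning

0≤q-p : ∀ {p q} → p ≤ q → 0ℚ ≤ q - p
0≤q-p {p} {q} p≤q = subst (_≤ q - p) (ℚ.+-inverseʳ p) (ℚ.+-monoˡ-≤ (- p) p≤q)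

p≤p+q : ∀ p {q} → 0ℚ ≤ q → p ≤ p + q
p≤p+q p {q} 0≤q = subst (_≤ p + q) (ℚ.+-identityʳ p) (ℚ.+-monoʳ-≤ p 0≤q)

+-cancelʳ-≤ : ∀ {p q} r → p + r ≤ q + r → p ≤ q
+-cancelʳ-≤ {p} {q} r p+r≤q+r = begin
  p            ≡⟨ solve 2 (λ p r → p := (p :+ r) :- r) refl p r ⟩
  (p + r) - r  ≤⟨ ℚ.+-monoˡ-≤ (- r) p+r≤q+r ⟩
  (q + r) - r  ≡⟨ solve 2 (λ q r → (q :+ r) :- r := q) refl q r ⟩
  q            ∎
  where open ℚ.≤-Reasoning

+-swap-≤ : ∀ {p q} r s → p + s ≤ q + r → p - r ≤ q - s
+-swap-≤ {p} {q} r s p+s≤q+r = begin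
  p - r              ≡⟨ solve 3 (λ p r s → p :- r := (p :+ s) :- (r :+ s)) refl p r s ⟩
  (p + s) - (r + s)  ≤⟨ ℚ.+-monoˡ-≤ (- (r + s)) p+s≤q+r ⟩
  (q + r) - (r + s)  ≡⟨ solve 3 (λ q r s → (q :+ r) :- (r :+ s) := q :- s) refl q r s ⟩
  q - s              ∎
  where open ℚ.≤-Reasoning

<⇒≱ : ∀ {p q} → p < q → ¬ q ≤ p
<⇒≱ p<q q≤p = ℚ.<-irrefl refl (ℚ.<-≤-trans p<q q≤p)

≤∧≢⇒< : ∀ {p q} → p ≤ q → p ≢ q → p < q
≤∧≢⇒< {p} {q} p≤q p≢q with ℚ.<-cmp p q
... | tri< p<q _ _ = p<q
... | tri≈ _ p≡q _ = contradiction p≡q p≢q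
... | tri> _ _ q<p = contradiction p≤q (<⇒≱ q<p)

+-nonNeg-≡0 : ∀ {p q} → 0ℚ ≤ p → 0ℚ ≤ q → p + q ≡ 0ℚ → p ≡ 0ℚ × q ≡ 0ℚ
+-nonNeg-≡0 {p} {q} 0≤p 0≤q p+q≡0 =
  ℚ.≤-antisym (subst₂ _≤_ (ℚ.+-identityʳ p) p+q≡0 (ℚ.+-monoʳ-≤ p 0≤q)) 0≤p ,
  ℚ.≤-antisym (subst₂ _≤_ (ℚ.+-identityˡ q) p+q≡0 (ℚ.+-monoˡ-≤ q 0≤p)) 0≤q

*-nonNeg : ∀ {p q} → 0ℚ ≤ p → 0ℚ ≤ q → 0ℚ ≤ p * q
*-nonNeg {p} {q} 0≤p 0≤q = ℚ.nonNegative⁻¹ (p * q)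
  {{ℚ.nonNeg*nonNeg⇒nonNeg p {{nonNegative 0≤p}} q {{nonNegative 0≤q}}}}

*-cancelˡ-≡0 : ∀ {p q} → 0ℚ < p → p * q ≡ 0ℚ → q ≡ 0ℚ
*-cancelˡ-≡0 {p} {q} 0<p pq≡0 = begin
  q                ≡⟨ ℚ.*-identityˡ q ⟨
  1ℚ * q           ≡⟨ cong (_* q) (ℚ.*-inverseˡ p) ⟨
  1/ p * p * q     ≡⟨ ℚ.*-assoc (1/ p) p q ⟩
  1/ p * (p * q)   ≡⟨ cong (1/ p *_) pq≡0 ⟩
  1/ p * 0ℚ        ≡⟨ ℚ.*-zeroʳ (1/ p) ⟩
  0ℚ               ∎
  where
  open ≡-Reasoning
  instance _ = ℚ.pos⇒nonZero p {{positive 0<p}}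

double-injective : ∀ {p q} → p + p ≡ q + q → p ≡ q
double-injective {p} {q} 2p≡2q = begin
  p              ≡⟨ solve 1 (λ p → p := (p :+ p) :* con ½) refl p ⟩
  (p + p) * ½    ≡⟨ cong (_* ½) 2p≡2q ⟩
  (q + q) * ½    ≡⟨ solve 1 (λ q → (q :+ q) :* con ½ := q) refl q ⟩
  q              ∎
  where open ≡-Reasoning

0<⊓ : ∀ {p q} → 0ℚ < p → 0ℚ < q → 0ℚ < p ⊓ q
0<⊓ {p} {q} 0<p 0<q with ℚ.⊓-sel p q
... | inj₁ p⊓q≡p = subst (0ℚ <_) (sym p⊓q≡p) 0<p
... | inj₂ p⊓q≡q = subst (0ℚ <_) (sym p⊓q≡q) 0<q

0≤1 : 0ℚ ≤ 1ℚ
0≤1 = ℚ.<⇒≤ (ℚ.positive⁻¹ 1ℚ)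

sumᶠ≡sum : ∀ {k} (g : Fin k → ℚ) → sumᶠ g ≡ sum g
sumᶠ≡sum {ℕ.zero}  g = refl
sumᶠ≡sum {ℕ.suc k} g = cong (g zero +_) (sumᶠ≡sum (g ∘ suc))

sumᶠ-cong : ∀ {k} {g h : Fin k → ℚ} → (∀ i → g i ≡ h i) → sumᶠ g ≡ sumᶠ h
sumᶠ-cong {ℕ.zero}  g≗h = refl
sumᶠ-cong {ℕ.suc k} g≗h = cong₂ _+_ (g≗h zero) (sumᶠ-cong (g≗h ∘ suc))

sumᶠ-zero : ∀ {k} → sumᶠ {k} (λ _ → 0ℚ) ≡ 0ℚ
sumᶠ-zero {ℕ.zero}  = refl
sumᶠ-zero {ℕ.suc k} = trans (ℚ.+-identityˡ _) (sumᶠ-zero {k})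

sumᶠ-+ : ∀ {k} (g h : Fin k → ℚ) → sumᶠ (λ i → g i + h i) ≡ sumᶠ g + sumᶠ h
sumᶠ-+ g h = begin
  sumᶠ (λ i → g i + h i)  ≡⟨ sumᶠ≡sum (λ i → g i + h i) ⟩
  sum (λ i → g i + h i)   ≡⟨ ∑-distrib-+ g h ⟩
  sum g + sum h           ≡⟨ cong₂ _+_ (sumᶠ≡sum g) (sumᶠ≡sum h) ⟨
  sumᶠ g + sumᶠ h         ∎
  where open ≡-Reasoning

sumᶠ-*ˡ : ∀ {k} c (g : Fin k → ℚ) → sumᶠ (λ i → c * g i) ≡ c * sumᶠ g
sumᶠ-*ˡ c g = begin
  sumᶠ (λ i → c * g i)  ≡⟨ sumᶠ≡sum (λ i → c * g i) ⟩
  sum (λ i → c * g i)   ≡⟨ *-distribˡ-sum c g ⟨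
  c * sum g             ≡⟨ cong (c *_) (sumᶠ≡sum g) ⟨
  c * sumᶠ g            ∎
  where open ≡-Reasoning

sumᶠ-comm : ∀ {k l} (g : Fin k → Fin l → ℚ) →
            sumᶠ (λ i → sumᶠ (λ j → g i j)) ≡ sumᶠ (λ j → sumᶠ (λ i → g i j))
sumᶠ-comm g = begin
  sumᶠ (λ i → sumᶠ (g i))             ≡⟨ sumᶠ-cong (λ i → sumᶠ≡sum (g i)) ⟩
  sumᶠ (λ i → sum (g i))              ≡⟨ sumᶠ≡sum (λ i → sum (g i)) ⟩
  sum (λ i → sum (g i))               ≡⟨ ∑-comm g ⟩
  sum (λ j → sum (λ i → g i j))       ≡⟨ sumᶠ≡sum (λ j → sum (λ i → g i j)) ⟨
  sumᶠ (λ j → sum (λ i → g i j))      ≡⟨ sumᶠ-cong (λ j → sumᶠ≡sum (λ i → g i j)) ⟨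
  sumᶠ (λ j → sumᶠ (λ i → g i j))     ∎
  where open ≡-Reasoning

sumᶠ-− : ∀ {k} (g h : Fin k → ℚ) → sumᶠ (λ i → g i - h i) ≡ sumᶠ g - sumᶠ h
sumᶠ-− {ℕ.zero}  g h = refl
sumᶠ-− {ℕ.suc k} g h =
  trans (cong (g zero - h zero +_) (sumᶠ-− (g ∘ suc) (h ∘ suc)))
        (solve 4 (λ a b s t → (a :- b) :+ (s :- t) := (a :+ s) :- (b :+ t))
               refl (g zero) (h zero) (sumᶠ (g ∘ suc)) (sumᶠ (h ∘ suc)))

sumᶠ-affine : ∀ {k} c d (g h : Fin k → ℚ) →
              sumᶠ (λ i → c * (g i - d * h i)) ≡ c * (sumᶠ g - d * sumᶠ h)
sumᶠ-affine c d g h = begin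
  sumᶠ (λ i → c * (g i - d * h i))   ≡⟨ sumᶠ-*ˡ c (λ i → g i - d * h i) ⟩
  c * sumᶠ (λ i → g i - d * h i)     ≡⟨ cong (c *_) (sumᶠ-− g (λ i → d * h i)) ⟩
  c * (sumᶠ g - sumᶠ (λ i → d * h i)) ≡⟨ cong (λ t → c * (sumᶠ g - t)) (sumᶠ-*ˡ d h) ⟩
  c * (sumᶠ g - d * sumᶠ h)          ∎
  where open ≡-Reasoning

sumᶠ-mono : ∀ {k} {g h : Fin k → ℚ} → (∀ i → g i ≤ h i) → sumᶠ g ≤ sumᶠ h
sumᶠ-mono {ℕ.zero}  g≤h = ℚ.≤-refl
sumᶠ-mono {ℕ.suc k} g≤h = ℚ.+-mono-≤ (g≤h zero) (sumᶠ-mono (g≤h ∘ suc))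

sumᶠ-nonNeg : ∀ {k} {g : Fin k → ℚ} → (∀ i → 0ℚ ≤ g i) → 0ℚ ≤ sumᶠ g
sumᶠ-nonNeg {k} {g} 0≤g = subst (_≤ sumᶠ g) (sumᶠ-zero {k}) (sumᶠ-mono 0≤g)

sumᶠ-nonNeg-≡0 : ∀ {k} {g : Fin k → ℚ} → (∀ i → 0ℚ ≤ g i) → sumᶠ g ≡ 0ℚ → ∀ i → g i ≡ 0ℚ
sumᶠ-nonNeg-≡0 0≤g Σg≡0 zero    = proj₁ (+-nonNeg-≡0 (0≤g zero) (sumᶠ-nonNeg (0≤g ∘ suc)) Σg≡0)
sumᶠ-nonNeg-≡0 0≤g Σg≡0 (suc i) =
  sumᶠ-nonNeg-≡0 (0≤g ∘ suc) (proj₂ (+-nonNeg-≡0 (0≤g zero) (sumᶠ-nonNeg (0≤g ∘ suc)) Σg≡0)) i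

sumᶠ-single : ∀ {k} (g : Fin k → ℚ) a → (∀ i → i ≢ a → g i ≡ 0ℚ) → sumᶠ g ≡ g a
sumᶠ-single {ℕ.suc k} g zero g≡0 =
  trans (cong (g zero +_) (trans (sumᶠ-cong (λ i → g≡0 (suc i) λ ())) (sumᶠ-zero {k}))) (ℚ.+-identityʳ _)
sumᶠ-single g (suc a) g≡0 =
  trans (cong (_+ sumᶠ (g ∘ suc)) (g≡0 zero λ ()))
        (trans (ℚ.+-identityˡ (sumᶠ (g ∘ suc))) (sumᶠ-single (g ∘ suc) a (λ i i≢a → g≡0 (suc i) (i≢a ∘ suc-injective))))

sumᶠ-twice : ∀ {k} (g h : Fin k → ℚ) → sumᶠ (λ i → g i + g i + h i) ≡ sumᶠ g + sumᶠ g + sumᶠ h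
sumᶠ-twice g h = trans (sumᶠ-+ (λ i → g i + g i) h) (cong (_+ sumᶠ h) (sumᶠ-+ g g))

when : Bool → ℚ → ℚ
when b q = if b then q else 0ℚ

when-yes : ∀ {p} {P : Set p} (P? : Dec P) {q} → P → when ⌊ P? ⌋ q ≡ q
when-yes (yes _) _  = refl
when-yes (no ¬p) p = contradiction p ¬p

when-no : ∀ {p} {P : Set p} (P? : Dec P) {q} → ¬ P → when ⌊ P? ⌋ q ≡ 0ℚ
when-no (yes p) ¬p = contradiction p ¬p
when-no (no _)  _  = refl

when-nonNeg : ∀ b {q} → 0ℚ ≤ q → 0ℚ ≤ when b q
when-nonNeg true  0≤q = 0≤q
when-nonNeg false _   = ℚ.≤-refl

*-when-comm : ∀ b p q → p * when b q ≡ q * when b p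
*-when-comm true  p q = ℚ.*-comm p q
*-when-comm false p q = trans (ℚ.*-zeroʳ p) (sym (ℚ.*-zeroʳ q))

when-affine : ∀ b c d g h → when b (c * (g - d * h)) ≡ c * (when b g - d * when b h)
when-affine true  c d g h = refl
when-affine false c d g h = solve 2 (λ c d → con 0ℚ := c :* (con 0ℚ :- d :* con 0ℚ)) refl c d

when-zero : ∀ b → when b 0ℚ ≡ 0ℚ
when-zero true  = refl
when-zero false = refl

sumWhere-affine : ∀ {k} (P : Fin k → Set) (P? : ∀ i → Dec (P i)) c d (g h : Fin k → ℚ) →
                  sumWhere P P? (λ i → c * (g i - d * h i)) ≡ c * (sumWhere P P? g - d * sumWhere P P? h)
sumWhere-affine P P? c d g h =
  trans (sumᶠ-cong (λ i → when-affine ⌊ P? i ⌋ c d (g i) (h i)))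
        (sumᶠ-affine c d (λ i → when ⌊ P? i ⌋ (g i)) (λ i → when ⌊ P? i ⌋ (h i)))

when-<-suc : ∀ k r v → when ⌊ k ℕ.<? ℕ.suc r ⌋ v ≡ when ⌊ k ℕ.<? r ⌋ v + when ⌊ k ℕ.≟ r ⌋ v
when-<-suc k r v with k ℕ.<? ℕ.suc r | k ℕ.<? r | k ℕ.≟ r
... | yes _     | yes _   | no _     = sym (ℚ.+-identityʳ v)
... | yes _     | no _    | yes _    = sym (ℚ.+-identityˡ v)
... | no _      | no _    | no _     = refl
... | _         | yes k<r | yes refl = contradiction k<r (ℕ.n≮n k)
... | yes k<1+r | no k≮r  | no k≢r   = contradiction (ℕ.≤∧≢⇒< (ℕ.s≤s⁻¹ k<1+r) k≢r) k≮r
... | no k≮1+r  | _       | yes refl = contradiction (ℕ.n<1+n k) k≮1+r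
... | no k≮1+r  | yes k<r | _        = contradiction (ℕ.m<n⇒m<1+n k<r) k≮1+r

when-<-suc-complement : ∀ k r v → when ⌊ k ℕ.<? ℕ.suc r ⌋ v + when ⌊ r ℕ.<? k ⌋ v ≡ v
when-<-suc-complement k r v with k ℕ.<? ℕ.suc r | r ℕ.<? k
... | yes _     | no _    = ℚ.+-identityʳ v
... | no _      | yes _   = ℚ.+-identityˡ v
... | yes k<1+r | yes r<k = contradiction (ℕ.s≤s⁻¹ k<1+r) (ℕ.<⇒≱ r<k)
... | no k≮1+r  | no r≮k  = contradiction (ℕ.s≤s (ℕ.≮⇒≥ r≮k)) k≮1+r

when-<-mono : ∀ {r s} k {v} → 0ℚ ≤ v → r ℕ.≤ s → when ⌊ k ℕ.<? r ⌋ v ≤ when ⌊ k ℕ.<? s ⌋ v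
when-<-mono {r} {s} k 0≤v r≤s with k ℕ.<? r | k ℕ.<? s
... | yes _   | yes _  = ℚ.≤-refl
... | yes k<r | no k≮s = contradiction (ℕ.<-≤-trans k<r r≤s) k≮s
... | no _    | k<?s   = when-nonNeg ⌊ k<?s ⌋ 0≤v

_≼_ : ℚ → ℚ → Set
m ≼ q = 0ℚ < q → m ≤ q

≼-+ : ∀ {m p q} → 0ℚ ≤ p → 0ℚ ≤ q → m ≼ p → m ≼ q → m ≼ (p + q)
≼-+ {m} {p} {q} 0≤p 0≤q m≼p m≼q 0<p+q with 0ℚ ℚ.<? p
... | yes 0<p = ℚ.≤-trans (m≼p 0<p) (p≤p+q p 0≤q)
... | no 0≮p with ℚ.≤-antisym (ℚ.≮⇒≥ 0≮p) 0≤p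
...   | refl = subst (m ≤_) (sym (ℚ.+-identityˡ q)) (m≼q (subst (0ℚ <_) (ℚ.+-identityˡ q) 0<p+q))

≼-sumᶠ : ∀ {k m} {g : Fin k → ℚ} → (∀ i → 0ℚ ≤ g i) → (∀ i → m ≼ g i) → m ≼ sumᶠ g
≼-sumᶠ {ℕ.zero}  _   _   0<0 = contradiction 0<0 (ℚ.<-irrefl refl)
≼-sumᶠ {ℕ.suc k} 0≤g m≼g = ≼-+ (0≤g zero) (sumᶠ-nonNeg (0≤g ∘ suc)) (m≼g zero) (≼-sumᶠ (0≤g ∘ suc) (m≼g ∘ suc))

≼-when : ∀ b {m q} → m ≼ q → m ≼ when b q
≼-when true  m≼q = m≼q
≼-when false _   0<0 = contradiction 0<0 (ℚ.<-irrefl refl)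

∃-positiveLowerBound : ∀ {k} (g : Fin k → ℚ) → ∃ λ m → 0ℚ < m × m ≤ 1ℚ × ∀ i → m ≼ g i
∃-positiveLowerBound {ℕ.zero}  g = 1ℚ , ℚ.positive⁻¹ 1ℚ , ℚ.≤-refl , λ ()
∃-positiveLowerBound {ℕ.suc k} g with ∃-positiveLowerBound (g ∘ suc) | 0ℚ ℚ.<? g zero
... | m , 0<m , m≤1 , m≼g | no 0≮g₀ = m , 0<m , m≤1 , λ where
  zero    0<g₀ → contradiction 0<g₀ 0≮g₀
  (suc i)      → m≼g i
... | m , 0<m , m≤1 , m≼g | yes 0<g₀ = g zero ⊓ m , 0<⊓ 0<g₀ 0<m , ℚ.p≤q⇒r⊓p≤q (g zero) m≤1 , λ where
  zero    _    → ℚ.p⊓q≤p (g zero) m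
  (suc i) 0<gᵢ → ℚ.≤-trans (ℚ.p⊓q≤q (g zero) m) (m≼g i 0<gᵢ)

∃-positiveLowerBound₂ : ∀ {k l} (g : Fin k → Fin l → ℚ) → ∃ λ m → 0ℚ < m × m ≤ 1ℚ × ∀ i j → m ≼ g i j
∃-positiveLowerBound₂ g with ∃-positiveLowerBound (λ i → proj₁ (∃-positiveLowerBound (g i)))
... | m , 0<m , m≤1 , m≼mᵢ = m , 0<m , m≤1 , λ i j 0<gᵢⱼ →
  let mᵢ , 0<mᵢ , _ , mᵢ≼gᵢ = ∃-positiveLowerBound (g i) in ℚ.≤-trans (m≼mᵢ i 0<mᵢ) (mᵢ≼gᵢ j 0<gᵢⱼ)

≯∧≢⇒< : ∀ {n} (ρ : Fin n ↔ Fin n) {a b} → ¬ Inverse.to ρ b <ᶠ Inverse.to ρ a → a ≢ b → Inverse.to ρ a <ᶠ Inverse.to ρ b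
≯∧≢⇒< ρ b≯a a≢b = FP.≤∧≢⇒< (ℕ.≮⇒≥ b≯a) (a≢b ∘ Injection.injective (↔⇒↣ ρ))

module Ranking {n : ℕ} (ρ : Fin n ↔ Fin n) (y : Fin n → ℚ) where

  rank : Fin n → Fin n
  rank = Inverse.to ρ

  rank-injective : Injective _≡_ _≡_ rank
  rank-injective = Injection.injective (↔⇒↣ ρ)

  before after : Fin n → ℚ
  before a = sumᶠ (λ i → when ⌊ rank i <ᶠ? rank a ⌋ (y i))
  after  a = sumᶠ (λ i → when ⌊ rank a <ᶠ? rank i ⌋ (y i))

  prefix : ℕ → ℚ
  prefix r = sumᶠ (λ i → when ⌊ toℕ (rank i) ℕ.<? r ⌋ (y i))

  prefix-zero : prefix 0 ≡ 0ℚ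
  prefix-zero = sumᶠ-zero {n}

  prefix-all : prefix n ≡ sumᶠ y
  prefix-all = sumᶠ-cong (λ i → when-yes (toℕ (rank i) ℕ.<? n) (toℕ<n (rank i)))

  prefix-suc : ∀ a → prefix (ℕ.suc (toℕ (rank a))) ≡ before a + y a
  prefix-suc a = begin
    prefix (ℕ.suc r)                                 ≡⟨ sumᶠ-cong (λ i → when-<-suc (toℕ (rank i)) r (y i)) ⟩
    sumᶠ (λ i → when ⌊ toℕ (rank i) ℕ.<? r ⌋ (y i) + at-a i) ≡⟨ sumᶠ-+ (λ i → when ⌊ toℕ (rank i) ℕ.<? r ⌋ (y i)) at-a ⟩
    before a + sumᶠ at-a                             ≡⟨ cong (before a +_) (sumᶠ-single at-a a off-a) ⟩
    before a + at-a a                                ≡⟨ cong (before a +_) (when-yes (r ℕ.≟ r) refl) ⟩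
    before a + y a                                   ∎
    where
    open ≡-Reasoning
    r : ℕ
    r = toℕ (rank a)
    at-a : Fin n → ℚ
    at-a i = when ⌊ toℕ (rank i) ℕ.≟ r ⌋ (y i)
    off-a : ∀ i → i ≢ a → at-a i ≡ 0ℚ
    off-a i i≢a = when-no (toℕ (rank i) ℕ.≟ r) (i≢a ∘ rank-injective ∘ toℕ-injective)

  before+self+after : ∀ a → before a + y a + after a ≡ sumᶠ y
  before+self+after a = begin
    before a + y a + after a                 ≡⟨ cong (_+ after a) (prefix-suc a) ⟨
    prefix (ℕ.suc r) + after a               ≡⟨ sumᶠ-+ upTo-a beyond-a ⟨
    sumᶠ (λ i → upTo-a i + beyond-a i)       ≡⟨ sumᶠ-cong (λ i → when-<-suc-complement (toℕ (rank i)) r (y i)) ⟩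
    sumᶠ y                                   ∎
    where
    open ≡-Reasoning
    r : ℕ
    r = toℕ (rank a)
    upTo-a beyond-a : Fin n → ℚ
    upTo-a   i = when ⌊ toℕ (rank i) ℕ.<? ℕ.suc r ⌋ (y i)
    beyond-a i = when ⌊ rank a <ᶠ? rank i ⌋ (y i)

  ranked : ∀ {r} → r ℕ.< n → ∃ λ a → toℕ (rank a) ≡ r
  ranked r<n = Inverse.from ρ (fromℕ< r<n) ,
               trans (cong toℕ (Inverse.strictlyInverseˡ ρ (fromℕ< r<n))) (toℕ-fromℕ< r<n)

  subinterval-at-rank : ∀ {r θ} → r ℕ.< n → prefix r ≤ θ → θ ≤ prefix (ℕ.suc r) →
                        ∃ λ a → before a ≤ θ × θ ≤ before a + y a
  subinterval-at-rank {θ = θ} r<n prefixᵣ≤θ θ≤prefixᵣ₊₁ with ranked r<n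
  ... | a , refl = a , prefixᵣ≤θ , subst (θ ≤_) (prefix-suc a) θ≤prefixᵣ₊₁

  module _ (y≥0 : ∀ i → 0ℚ ≤ y i) where

    prefix-mono : ∀ {r s} → r ℕ.≤ s → prefix r ≤ prefix s
    prefix-mono r≤s = sumᶠ-mono (λ i → when-<-mono (toℕ (rank i)) (y≥0 i) r≤s)

    before-mono : ∀ {a b} → rank a <ᶠ rank b → before a + y a ≤ before b
    before-mono {a} {b} a<b = subst (_≤ before b) (prefix-suc a) (prefix-mono a<b)

  Σbefore≡Σafter : sumᶠ (λ i → y i * before i) ≡ sumᶠ (λ i → y i * after i)
  Σbefore≡Σafter = begin
    sumᶠ (λ i → y i * before i)                 ≡⟨ sumᶠ-cong (λ i → sumᶠ-*ˡ (y i) (λ j → ≺ j i (y j))) ⟨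
    sumᶠ (λ i → sumᶠ (λ j → y i * ≺ j i (y j)))  ≡⟨ sumᶠ-comm (λ i j → y i * ≺ j i (y j)) ⟩
    sumᶠ (λ j → sumᶠ (λ i → y i * ≺ j i (y j)))  ≡⟨ sumᶠ-cong (λ j → sumᶠ-cong (λ i → *-when-comm ⌊ rank j <ᶠ? rank i ⌋ (y i) (y j))) ⟩
    sumᶠ (λ j → sumᶠ (λ i → y j * ≺ j i (y i)))  ≡⟨ sumᶠ-cong (λ j → sumᶠ-*ˡ (y j) (λ i → ≺ j i (y i))) ⟩
    sumᶠ (λ j → y j * after j)                  ∎
    where
    open ≡-Reasoning
    ≺ : Fin n → Fin n → ℚ → ℚ
    ≺ j i = when ⌊ rank j <ᶠ? rank i ⌋

  Σbefore-twice : sumᶠ (λ i → y i * before i) + sumᶠ (λ i → y i * before i) + sumᶠ (λ i → y i * y i)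
                  ≡ sumᶠ y * sumᶠ y
  Σbefore-twice = begin
    B + B + Q                                                  ≡⟨ cong (λ t → B + t + Q) Σbefore≡Σafter ⟩
    B + A + Q                                                  ≡⟨ solve 3 (λ b a q → b :+ a :+ q := b :+ q :+ a) refl B A Q ⟩
    B + Q + A                                                  ≡⟨ cong (_+ A) (sumᶠ-+ (λ i → y i * before i) (λ i → y i * y i)) ⟨
    sumᶠ (λ i → y i * before i + y i * y i) + A                ≡⟨ sumᶠ-+ (λ i → y i * before i + y i * y i) (λ i → y i * after i) ⟨
    sumᶠ (λ i → y i * before i + y i * y i + y i * after i)    ≡⟨ sumᶠ-cong factor ⟩
    sumᶠ (λ i → sumᶠ y * y i)                                  ≡⟨ sumᶠ-*ˡ (sumᶠ y) y ⟩
    sumᶠ y * sumᶠ y                                            ∎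
    where
    open ≡-Reasoning
    B A Q : ℚ
    B = sumᶠ (λ i → y i * before i)
    A = sumᶠ (λ i → y i * after i)
    Q = sumᶠ (λ i → y i * y i)
    factor : ∀ i → y i * before i + y i * y i + y i * after i ≡ sumᶠ y * y i
    factor i = begin
      y i * before i + y i * y i + y i * after i  ≡⟨ solve 4 (λ v b a s → v :* b :+ v :* v :+ v :* a := (b :+ v :+ a) :* v) refl (y i) (before i) (after i) (sumᶠ y) ⟩
      (before i + y i + after i) * y i            ≡⟨ cong (_* y i) (before+self+after i) ⟩
      sumᶠ y * y i                                ∎

  Σafter-twice : sumᶠ (λ i → y i * after i) + sumᶠ (λ i → y i * after i) + sumᶠ (λ i → y i * y i)
                 ≡ sumᶠ y * sumᶠ y
  Σafter-twice = subst (λ t → t + t + sumᶠ (λ i → y i * y i) ≡ sumᶠ y * sumᶠ y) Σbefore≡Σafter Σbefore-twice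

discrete-ivt : ∀ (L : ℕ → ℚ) {θ} n → L 0 ≤ θ → θ ≤ L (ℕ.suc n) →
               ∃ λ r → r ℕ.≤ n × L r ≤ θ × θ ≤ L (ℕ.suc r)
discrete-ivt L ℕ.zero L₀≤θ θ≤L₁ = 0 , ℕ.z≤n , L₀≤θ , θ≤L₁
discrete-ivt L {θ} (ℕ.suc n) L₀≤θ θ≤L₂₊ₙ with θ ℚ.≤? L (ℕ.suc n)
... | yes θ≤L₁₊ₙ = let r , r≤n , bounds = discrete-ivt L n L₀≤θ θ≤L₁₊ₙ in r , ℕ.m≤n⇒m≤1+n r≤n , bounds
... | no θ≰L₁₊ₙ  = ℕ.suc n , ℕ.≤-refl , ℚ.<⇒≤ (ℚ.≰⇒> θ≰L₁₊ₙ) , θ≤L₂₊ₙ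

∃-subinterval : ∀ {n} (ρ : Fin n ↔ Fin n) (y : Fin n → ℚ) {θ} → sumᶠ y ≡ 1ℚ → 0ℚ ≤ θ → θ ≤ 1ℚ →
                ∃ λ a → Ranking.before ρ y a ≤ θ × θ ≤ Ranking.before ρ y a + y a
∃-subinterval {ℕ.zero}  ρ y Σy≡1 _ _ = contradiction Σy≡1 λ ()
∃-subinterval {ℕ.suc n} ρ y {θ} Σy≡1 0≤θ θ≤1 =
  let open Ranking ρ y
      r , r≤n , prefixᵣ≤θ , θ≤prefixᵣ₊₁ = discrete-ivt prefix n (subst (_≤ θ) (sym prefix-zero) 0≤θ)
                                                      (subst (θ ≤_) (sym (trans prefix-all Σy≡1)) θ≤1)
  in  subinterval-at-rank (ℕ.s≤s r≤n) prefixᵣ≤θ θ≤prefixᵣ₊₁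

injective⇒strictlySurjective : ∀ {n} {f : Fin n → Fin n} → Injective _≡_ _≡_ f → StrictlySurjective _≡_ f
injective⇒strictlySurjective {ℕ.suc m} {f} f-injective j with any? (λ i → f i ≟ᶠ j)
... | yes hit = hit
... | no miss = contradiction (injective⇒≤ g-injective) ℕ.1+n≰n
  where
  g : Fin (ℕ.suc m) → Fin m
  g i = punchOut {i = j} {j = f i} (λ j≡fi → miss (i , sym j≡fi))
  g-injective : Injective _≡_ _≡_ g
  g-injective {a} {b} = f-injective ∘ punchOut-injective (λ j≡fa → miss (a , sym j≡fa)) (λ j≡fb → miss (b , sym j≡fb))

agree-everywhere : ∀ {n} {f g : Fin n → Fin n} {i₀} → StrictlySurjective _≡_ f → Injective _≡_ _≡_ g →
                   (∀ i → i ≢ i₀ → f i ≡ g i) → ∀ i → f i ≡ g i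
agree-everywhere {g = g} {i₀} f-onto g-injective agree i with i ≟ᶠ i₀
... | no i≢i₀ = agree i i≢i₀
... | yes refl with f-onto (g i)
...   | v , fv≡gi with v ≟ᶠ i
...     | yes refl = fv≡gi
...     | no v≢i   = contradiction (g-injective (trans (sym (agree v v≢i)) fv≡gi)) v≢i

Matrix : ℕ → Set
Matrix n = Fin n → Fin n → ℚ

record FeasibleFor {n} (I : Instance n) (x : Matrix n) : Set where
  field
    rowSum      : ∀ w → sumᶠ (x w) ≡ 1ℚ
    colSum      : ∀ f → sumᶠ (λ w → x w f) ≡ 1ℚ
    below≤above : ∀ w f → belowSum I x w f ≤ aboveSum I x w f
    nonNeg      : ∀ w f → 0ℚ ≤ x w f

module _ {n} {A B : Instance n} {x : Matrix n} where

  feasibleˡ : Feasible A B x → FeasibleFor A x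
  feasibleˡ (rows , cols , cutA , _ , x≥0) = record
    { rowSum = rows ; colSum = cols ; below≤above = λ w f → p-q≤0⇒p≤q (cutA w f) ; nonNeg = x≥0 }

  feasibleʳ : Feasible A B x → FeasibleFor B x
  feasibleʳ (rows , cols , _ , cutB , x≥0) = record
    { rowSum = rows ; colSum = cols ; below≤above = λ w f → p-q≤0⇒p≤q (cutB w f) ; nonNeg = x≥0 }

  feasible : FeasibleFor A x → FeasibleFor B x → Feasible A B x
  feasible feasA feasB =
    rowSum , colSum , (λ w f → p≤q⇒p-q≤0 (below≤above w f)) ,
    (λ w f → p≤q⇒p-q≤0 (FeasibleFor.below≤above feasB w f)) , nonNeg
    where open FeasibleFor feasA

module Feasibility {n} {I : Instance n} {x : Matrix n} (feas : FeasibleFor I x) where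
  open FeasibleFor feas
  open Instance I

  -- Definitionally lowEnd I x w = W.before w, belowSum I x w = W.after w and
  -- aboveSum I x · f = F.before f.
  module W (w : Fin n) = Ranking (wRankBij w) (x w)
  module F (f : Fin n) = Ranking (fRankBij f) (λ w → x w f)

  highEnd+below≡1 : ∀ w f → highEnd I x w f + belowSum I x w f ≡ 1ℚ
  highEnd+below≡1 w f = trans (W.before+self+after w f) (rowSum w)

  lowEnd≤highEnd : ∀ w f → lowEnd I x w f ≤ highEnd I x w f
  lowEnd≤highEnd w f = p≤p+q (lowEnd I x w f) (nonNeg w f)

  highEnd≤lowEnd : ∀ {w f g} → PrefW I w f g → highEnd I x w f ≤ lowEnd I x w g
  highEnd≤lowEnd {w} = W.before-mono w (nonNeg w)

  above+self≤above : ∀ {f w w'} → PrefF I f w w' → aboveSum I x w f + x w f ≤ aboveSum I x w' f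
  above+self≤above {f} = F.before-mono f (λ v → nonNeg v f)

  Σx*below≡Σx*above : sumᶠ (λ w → sumᶠ (λ f → x w f * belowSum I x w f))
                    ≡ sumᶠ (λ w → sumᶠ (λ f → x w f * aboveSum I x w f))
  Σx*below≡Σx*above = double-injective (∙-cancelʳ Q (R + R) (C + C) (trans R+R+Q≡N (sym C+C+Q≡N)))
    where
    R C Q N : ℚ
    R = sumᶠ (λ w → sumᶠ (λ f → x w f * belowSum I x w f))
    C = sumᶠ (λ w → sumᶠ (λ f → x w f * aboveSum I x w f))
    Q = sumᶠ (λ w → sumᶠ (λ f → x w f * x w f))
    N = sumᶠ {n} (λ _ → 1ℚ)
    square-one : ∀ {s} → s ≡ 1ℚ → s * s ≡ 1ℚ
    square-one refl = refl
    R+R+Q≡N : R + R + Q ≡ N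
    R+R+Q≡N = trans (sym (sumᶠ-twice (λ w → sumᶠ (λ f → x w f * belowSum I x w f)) (λ w → sumᶠ (λ f → x w f * x w f))))
                    (sumᶠ-cong (λ w → trans (W.Σafter-twice w) (square-one (rowSum w))))
    C+C+Q≡N : C + C + Q ≡ N
    C+C+Q≡N = begin
      C + C + Q  ≡⟨ cong₂ (λ c q → c + c + q) (sumᶠ-comm (λ w f → x w f * aboveSum I x w f))
                                               (sumᶠ-comm (λ w f → x w f * x w f)) ⟩
      sumᶠ U + sumᶠ U + sumᶠ Q′                ≡⟨ sumᶠ-twice U Q′ ⟨
      sumᶠ (λ f → U f + U f + Q′ f)            ≡⟨ sumᶠ-cong (λ f → trans (F.Σbefore-twice f) (square-one (colSum f))) ⟩
      N                                        ∎
      where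
      open ≡-Reasoning
      U Q′ : Fin n → ℚ
      U  f = sumᶠ (λ w → x w f * aboveSum I x w f)
      Q′ f = sumᶠ (λ w → x w f * x w f)

  slack≡0 : ∀ w f → x w f * (aboveSum I x w f - belowSum I x w f) ≡ 0ℚ
  slack≡0 w f = sumᶠ-nonNeg-≡0 (slack≥0 w) (sumᶠ-nonNeg-≡0 (λ v → sumᶠ-nonNeg (slack≥0 v)) total≡0 w) f
    where
    slack : Fin n → Fin n → ℚ
    slack w f = x w f * (aboveSum I x w f - belowSum I x w f)
    slack≥0 : ∀ w f → 0ℚ ≤ slack w f
    slack≥0 w f = *-nonNeg (nonNeg w f) (0≤q-p (below≤above w f))
    xa xb : Fin n → Fin n → ℚ
    xa w f = x w f * aboveSum I x w f
    xb w f = x w f * belowSum I x w f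
    row-slack : ∀ w → sumᶠ (slack w) ≡ sumᶠ (xa w) - sumᶠ (xb w)
    row-slack w = trans (sumᶠ-cong (λ f → solve 3 (λ u a b → u :* (a :- b) := u :* a :- u :* b) refl
                                                  (x w f) (aboveSum I x w f) (belowSum I x w f)))
                        (sumᶠ-− (xa w) (xb w))
    total≡0 : sumᶠ (λ w → sumᶠ (slack w)) ≡ 0ℚ
    total≡0 = begin
      sumᶠ (λ w → sumᶠ (slack w))                                ≡⟨ sumᶠ-cong row-slack ⟩
      sumᶠ (λ w → sumᶠ (xa w) - sumᶠ (xb w))                     ≡⟨ sumᶠ-− (λ w → sumᶠ (xa w)) (λ w → sumᶠ (xb w)) ⟩
      sumᶠ (λ w → sumᶠ (xa w)) - sumᶠ (λ w → sumᶠ (xb w))        ≡⟨ cong (λ t → sumᶠ (λ w → sumᶠ (xa w)) - t) Σx*below≡Σx*above ⟩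
      sumᶠ (λ w → sumᶠ (xa w)) - sumᶠ (λ w → sumᶠ (xa w))        ≡⟨ ℚ.+-inverseʳ (sumᶠ (λ w → sumᶠ (xa w))) ⟩
      0ℚ                                                        ∎
      where open ≡-Reasoning

  tight : ∀ {w f} → 0ℚ < x w f → aboveSum I x w f ≡ belowSum I x w f
  tight {w} {f} 0<x = x∙y⁻¹≈ε⇒x≈y (aboveSum I x w f) (belowSum I x w f) (*-cancelˡ-≡0 0<x (slack≡0 w f))

  highEnd+above≡1 : ∀ {w f} → 0ℚ < x w f → highEnd I x w f + aboveSum I x w f ≡ 1ℚ
  highEnd+above≡1 {w} {f} 0<x = trans (cong (highEnd I x w f +_) (tight 0<x)) (highEnd+below≡1 w f)

  1≤highEnd+above : ∀ w f → 1ℚ ≤ highEnd I x w f + aboveSum I x w f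
  1≤highEnd+above w f = subst (_≤ highEnd I x w f + aboveSum I x w f) (highEnd+below≡1 w f)
                              (ℚ.+-monoʳ-≤ (highEnd I x w f) (below≤above w f))

  highEnd≤lowEnd-firm : ∀ {f w w'} → PrefF I f w w' → 0ℚ < x w' f → highEnd I x w' f ≤ lowEnd I x w f
  highEnd≤lowEnd-firm {f} {w} {w'} w≻w' 0<x = +-cancelʳ-≤ (aboveSum I x w' f) (begin
    highEnd I x w' f + aboveSum I x w' f         ≡⟨ highEnd+above≡1 0<x ⟩
    1ℚ                                           ≤⟨ 1≤highEnd+above w f ⟩
    lowEnd I x w f + x w f + aboveSum I x w f    ≡⟨ ℚ.+-assoc (lowEnd I x w f) (x w f) (aboveSum I x w f) ⟩
    lowEnd I x w f + (x w f + aboveSum I x w f)  ≡⟨ cong (lowEnd I x w f +_) (ℚ.+-comm (x w f) (aboveSum I x w f)) ⟩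
    lowEnd I x w f + (aboveSum I x w f + x w f)  ≤⟨ ℚ.+-monoʳ-≤ (lowEnd I x w f) (above+self≤above w≻w') ⟩
    lowEnd I x w f + aboveSum I x w' f           ∎)
    where open ℚ.≤-Reasoning

  ∃-rounding : ∀ {θ} → 0ℚ ≤ θ → θ ≤ 1ℚ → ∃ λ μ → ∀ w → InSubinterval I x θ w (μ w)
  ∃-rounding {θ} 0≤θ θ≤1 = (λ w → proj₁ (subinterval w)) , (λ w → proj₂ (subinterval w))
    where
    subinterval : ∀ w → ∃ λ f → InSubinterval I x θ w f
    subinterval w = ∃-subinterval (wRankBij w) (x w) (rowSum w) 0≤θ θ≤1

  module Rounding {θ} (θ∉ends : NoEndpoint I x θ) where

    interior : ∀ {w f} → InSubinterval I x θ w f → lowEnd I x w f < θ × θ < highEnd I x w f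
    interior {w} {f} (low≤θ , θ≤high) =
      ≤∧≢⇒< low≤θ (proj₁ (θ∉ends w f) ∘ sym) , ≤∧≢⇒< θ≤high (proj₂ (θ∉ends w f))

    weight-pos : ∀ {w f} → InSubinterval I x θ w f → 0ℚ < x w f
    weight-pos {w} {f} θ∈ = ≤∧≢⇒< (nonNeg w f) λ 0≡x →
      <⇒≱ (ℚ.<-trans (proj₁ (interior θ∈)) (proj₂ (interior θ∈)))
          (ℚ.≤-reflexive (trans (cong (lowEnd I x w f +_) (sym 0≡x)) (ℚ.+-identityʳ (lowEnd I x w f))))

    disjoint : ∀ {w f w' f'} → highEnd I x w f ≤ lowEnd I x w' f' →
               InSubinterval I x θ w f → InSubinterval I x θ w' f' → ⊥
    disjoint high≤low θ∈ θ∈′ = <⇒≱ (ℚ.<-trans (proj₁ (interior θ∈′)) (proj₂ (interior θ∈))) high≤low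

    subinterval-unique : ∀ {w f g} → InSubinterval I x θ w f → InSubinterval I x θ w g → f ≡ g
    subinterval-unique {w} {f} {g} θ∈f θ∈g with FP.<-cmp (wRank I w f) (wRank I w g)
    ... | tri< f≻g _ _ = ⊥-elim (disjoint (highEnd≤lowEnd f≻g) θ∈f θ∈g)
    ... | tri≈ _ eq _  = W.rank-injective w eq
    ... | tri> _ _ g≻f = ⊥-elim (disjoint (highEnd≤lowEnd g≻f) θ∈g θ∈f)

    rounding-stable : ∀ μ → (∀ w → InSubinterval I x θ w (μ w)) → Stable I μ
    rounding-stable μ θ∈μ = μ-injective , no-blocking
      where
      μ-injective : ∀ w w' → μ w ≡ μ w' → w ≡ w'
      μ-injective w w' μw≡μw' with FP.<-cmp (fRank I (μ w) w) (fRank I (μ w) w')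
      ... | tri< w≻w' _ _ = ⊥-elim (disjoint (highEnd≤lowEnd-firm w≻w' (weight-pos θ∈′)) θ∈′ (θ∈μ w))
        where θ∈′ = subst (InSubinterval I x θ w') (sym μw≡μw') (θ∈μ w')
      ... | tri≈ _ eq _   = F.rank-injective (μ w) eq
      ... | tri> _ _ w'≻w = ⊥-elim (disjoint (highEnd≤lowEnd-firm w'≻w (weight-pos (θ∈μ w))) (θ∈μ w) θ∈′)
        where θ∈′ = subst (InSubinterval I x θ w') (sym μw≡μw') (θ∈μ w')
      no-blocking : ∀ w f w' → μ w ≢ f → μ w' ≡ f → ¬ (PrefW I w f (μ w) × PrefF I f w w')
      no-blocking w f w' _ refl (f≻μw , w≻w') = disjoint w'-before-μw (θ∈μ w') (θ∈μ w)
        where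
        open ℚ.≤-Reasoning
        w'-before-μw : highEnd I x w' f ≤ lowEnd I x w (μ w)
        w'-before-μw = begin
          highEnd I x w' f  ≤⟨ highEnd≤lowEnd-firm w≻w' (weight-pos (θ∈μ w')) ⟩
          lowEnd I x w f    ≤⟨ lowEnd≤highEnd w f ⟩
          highEnd I x w f   ≤⟨ highEnd≤lowEnd f≻μw ⟩
          lowEnd I x w (μ w) ∎

module _ {n} {A B : Instance n} {x : Matrix n} {w} (same : SameList A B w) where

  lowEnd-sameList : ∀ f → lowEnd A x w f ≡ lowEnd B x w f
  lowEnd-sameList f = sumᶠ-cong (λ i → cong₂ (λ p q → when ⌊ p <ᶠ? q ⌋ (x w i)) (same i) (same f))

  InSubinterval-sameList : ∀ {θ f} → InSubinterval A x θ w f → InSubinterval B x θ w f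
  InSubinterval-sameList {f = f} (low≤θ , θ≤high) =
    subst (_≤ _) (lowEnd-sameList f) low≤θ , subst (_ ≤_) (cong (_+ x w f) (lowEnd-sameList f)) θ≤high

roundings-agree : ∀ {n} {A B : Instance n} {x : Matrix n} {w₀} → (∀ w → w ≢ w₀ → SameList A B w) →
                  FeasibleFor A x → FeasibleFor B x → ∀ {θ} → NoEndpoint A x θ → NoEndpoint B x θ →
                  ∀ μ μ′ → (∀ w → InSubinterval A x θ w (μ w)) → (∀ w → InSubinterval B x θ w (μ′ w)) →
                  ∀ w → μ w ≡ μ′ w
roundings-agree {A = A} {B} {x} same feasA feasB θ∉endsA θ∉endsB μ μ′ θ∈μ θ∈μ′ =
  agree-everywhere (injective⇒strictlySurjective (proj₁ (RA.rounding-stable μ θ∈μ) _ _))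
                   (proj₁ (RB.rounding-stable μ′ θ∈μ′) _ _)
                   (λ w w≢w₀ → RB.subinterval-unique (InSubinterval-sameList {A = A} {B} {x} (same w w≢w₀) (θ∈μ w)) (θ∈μ′ w))
  where
  module RA = Feasibility.Rounding feasA θ∉endsA
  module RB = Feasibility.Rounding feasB θ∉endsB

stable-under-both : ∀ {n} {A B : Instance n} {x : Matrix n} {w₀} → (∀ w → w ≢ w₀ → SameList A B w) →
                    FeasibleFor A x → FeasibleFor B x →
                    ∀ {θ} → 0ℚ ≤ θ → θ ≤ 1ℚ → NoEndpoint A x θ → NoEndpoint B x θ →
                    ∃ λ μ → (∀ w → InSubinterval A x θ w (μ w)) × (∀ w → InSubinterval B x θ w (μ w)) ×
                            Stable A μ × Stable B μ
stable-under-both {B = B} {x} same feasA feasB {θ} 0≤θ θ≤1 θ∉endsA θ∉endsB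
  with Feasibility.∃-rounding feasA 0≤θ θ≤1 | Feasibility.∃-rounding feasB 0≤θ θ≤1
... | μ , θ∈μ | μ′ , θ∈μ′ =
      let θ∈B : ∀ w → InSubinterval B x θ w (μ w)
          θ∈B w = subst (InSubinterval B x θ w) (sym (roundings-agree same feasA feasB θ∉endsA θ∉endsB μ μ′ θ∈μ θ∈μ′ w))
                        (θ∈μ′ w)
      in  μ , θ∈μ , θ∈B , Feasibility.Rounding.rounding-stable feasA θ∉endsA μ θ∈μ ,
                          Feasibility.Rounding.rounding-stable feasB θ∉endsB μ θ∈B

module _ {n} (I : Instance n) {x : Matrix n} (x≥0 : ∀ w f → 0ℚ ≤ x w f) where

  lowEnd-nonNeg : ∀ w f → 0ℚ ≤ lowEnd I x w f
  lowEnd-nonNeg w f = sumᶠ-nonNeg (λ i → when-nonNeg _ (x≥0 w i))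

  module _ {m} (m≼x : ∀ w f → m ≼ x w f) where

    ≼-lowEnd : ∀ w f → m ≼ lowEnd I x w f
    ≼-lowEnd w f = ≼-sumᶠ (λ i → when-nonNeg _ (x≥0 w i)) (λ i → ≼-when _ (m≼x w i))

    ≼-highEnd : ∀ w f → m ≼ highEnd I x w f
    ≼-highEnd w f = ≼-+ (lowEnd-nonNeg w f) (x≥0 w f) (≼-lowEnd w f) (m≼x w f)

    module _ {θ} (0<θ : 0ℚ < θ) (θ<m : θ < m) where

      noEndpoint : NoEndpoint I x θ
      noEndpoint w f = θ≢ (≼-lowEnd w f) , θ≢ (≼-highEnd w f)
        where
        θ≢ : ∀ {e} → m ≼ e → θ ≢ e
        θ≢ m≼e θ≡e = <⇒≱ θ<m (subst (m ≤_) (sym θ≡e) (m≼e (subst (0ℚ <_) θ≡e 0<θ)))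

      lowEnd≤θ⇒≡0 : ∀ {w f} → lowEnd I x w f ≤ θ → lowEnd I x w f ≡ 0ℚ
      lowEnd≤θ⇒≡0 {w} {f} low≤θ = ℚ.≤-antisym
        (ℚ.≮⇒≥ λ 0<low → <⇒≱ θ<m (ℚ.≤-trans (≼-lowEnd w f 0<low) low≤θ)) (lowEnd-nonNeg w f)

permutationMatrix : ∀ {n} → (Fin n → Fin n) → Matrix n
permutationMatrix μ w f = when ⌊ μ w ≟ᶠ f ⌋ 1ℚ

permutationMatrix-integral : ∀ {n} (μ : Fin n → Fin n) → Integral (permutationMatrix μ)
permutationMatrix-integral μ w f with μ w ≟ᶠ f
... | yes _ = ℤ.+ 1 , refl
... | no _  = ℤ.+ 0 , refl

module PermutationMatrix {n} (I : Instance n) (μ : Fin n → Fin n) (μ-stable : Stable I μ) where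
  open Instance I

  P : Matrix n
  P = permutationMatrix μ

  μ-injective : Injective _≡_ _≡_ μ
  μ-injective = proj₁ μ-stable _ _

  partner : Fin n → Fin n
  partner f = proj₁ (injective⇒strictlySurjective μ-injective f)

  μ-partner : ∀ f → μ (partner f) ≡ f
  μ-partner f = proj₂ (injective⇒strictlySurjective μ-injective f)

  partner-unique : ∀ {w f} → μ w ≡ f → w ≡ partner f
  partner-unique {f = f} μw≡f = μ-injective (trans μw≡f (sym (μ-partner f)))

  P-off : ∀ {w f} → μ w ≢ f → P w f ≡ 0ℚ
  P-off {w} {f} = when-no (μ w ≟ᶠ f)

  rowSum-P : ∀ w → sumᶠ (P w) ≡ 1ℚ
  rowSum-P w = trans (sumᶠ-single (P w) (μ w) (λ f f≢μw → P-off (f≢μw ∘ sym))) (when-yes (μ w ≟ᶠ μ w) refl)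

  colSum-P : ∀ f → sumᶠ (λ w → P w f) ≡ 1ℚ
  colSum-P f = trans (sumᶠ-single (λ w → P w f) (partner f) (λ w w≢ → P-off (w≢ ∘ partner-unique)))
                     (when-yes (μ (partner f) ≟ᶠ f) (μ-partner f))

  belowSum-P : ∀ w f → belowSum I P w f ≡ when ⌊ wRank I w f <ᶠ? wRank I w (μ w) ⌋ 1ℚ
  belowSum-P w f = trans (sumᶠ-single term (μ w) off) (cong (when ⌊ wRank I w f <ᶠ? wRank I w (μ w) ⌋) (when-yes (μ w ≟ᶠ μ w) refl))
    where
    term : Fin n → ℚ
    term f' = when ⌊ wRank I w f <ᶠ? wRank I w f' ⌋ (P w f')
    off : ∀ f' → f' ≢ μ w → term f' ≡ 0ℚ
    off f' f'≢μw = trans (cong (when ⌊ wRank I w f <ᶠ? wRank I w f' ⌋) (P-off (f'≢μw ∘ sym))) (when-zero _)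

  aboveSum-P : ∀ w f → aboveSum I P w f ≡ when ⌊ fRank I f (partner f) <ᶠ? fRank I f w ⌋ 1ℚ
  aboveSum-P w f = trans (sumᶠ-single term (partner f) off)
                         (cong (when ⌊ fRank I f (partner f) <ᶠ? fRank I f w ⌋) (when-yes (μ (partner f) ≟ᶠ f) (μ-partner f)))
    where
    term : Fin n → ℚ
    term w' = when ⌊ fRank I f w' <ᶠ? fRank I f w ⌋ (P w' f)
    off : ∀ w' → w' ≢ partner f → term w' ≡ 0ℚ
    off w' w'≢ = trans (cong (when ⌊ fRank I f w' <ᶠ? fRank I f w ⌋) (P-off (w'≢ ∘ partner-unique))) (when-zero _)

  below≤above-P : ∀ w f → belowSum I P w f ≤ aboveSum I P w f
  below≤above-P w f = subst₂ _≤_ (sym (belowSum-P w f)) (sym (aboveSum-P w f))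
                             (cut (wRank I w f <ᶠ? wRank I w (μ w)) (fRank I f (partner f) <ᶠ? fRank I f w))
    where
    cut : (d₁ : Dec (PrefW I w f (μ w))) (d₂ : Dec (PrefF I f (partner f) w)) → when ⌊ d₁ ⌋ 1ℚ ≤ when ⌊ d₂ ⌋ 1ℚ
    cut (no _)     d₂            = when-nonNeg ⌊ d₂ ⌋ 0≤1
    cut (yes _)    (yes _)       = ℚ.≤-refl
    cut (yes f≻μw) (no partner⊁w) = ⊥-elim (proj₂ μ-stable w f (partner f) μw≢f (μ-partner f) (f≻μw , w≻partner))
      where
      μw≢f : μ w ≢ f
      μw≢f μw≡f = FP.<-irrefl (cong (wRank I w) (sym μw≡f)) f≻μw
      w≻partner : PrefF I f w (partner f)
      w≻partner = ≯∧≢⇒< (fRankBij f) partner⊁w (μw≢f ∘ λ w≡partner → trans (cong μ w≡partner) (μ-partner f))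

  feasible-P : FeasibleFor I P
  feasible-P = record
    { rowSum = rowSum-P ; colSum = colSum-P ; below≤above = below≤above-P ; nonNeg = λ w f → when-nonNeg _ 0≤1 }

module Decomposition {n} {I : Instance n} {v : Matrix n} (feas : FeasibleFor I v)
                     {μ : Fin n → Fin n} (μ-stable : Stable I μ) {θ} (0<θ : 0ℚ < θ)
                     (θ∈μ : ∀ w → InSubinterval I v θ w (μ w))
                     (θ-small : ∀ {w f} → lowEnd I v w f ≤ θ → lowEnd I v w f ≡ 0ℚ)
                     {c} (0≤c : 0ℚ ≤ c) (1-θ*c≡1 : (1ℚ - θ) * c ≡ 1ℚ) where
  open FeasibleFor feas
  open Feasibility feas
  open PermutationMatrix I μ μ-stable

  highEnd-μ : ∀ w → highEnd I v w (μ w) ≡ v w (μ w)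
  highEnd-μ w = trans (cong (_+ v w (μ w)) (θ-small (proj₁ (θ∈μ w)))) (ℚ.+-identityˡ (v w (μ w)))

  θ≤v : ∀ w → θ ≤ v w (μ w)
  θ≤v w = subst (θ ≤_) (highEnd-μ w) (proj₂ (θ∈μ w))

  θ+below≤1 : ∀ {w f} → PrefW I w (μ w) f → θ + belowSum I v w f ≤ 1ℚ
  θ+below≤1 {w} {f} μw≻f = begin
    θ + belowSum I v w f                ≤⟨ ℚ.+-monoˡ-≤ (belowSum I v w f) (θ≤v w) ⟩
    v w (μ w) + belowSum I v w f        ≡⟨ cong (_+ belowSum I v w f) (highEnd-μ w) ⟨
    highEnd I v w (μ w) + belowSum I v w f ≤⟨ ℚ.+-monoˡ-≤ (belowSum I v w f) μw-before-f ⟩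
    highEnd I v w f + belowSum I v w f  ≡⟨ highEnd+below≡1 w f ⟩
    1ℚ                                  ∎
    where
    open ℚ.≤-Reasoning
    μw-before-f : highEnd I v w (μ w) ≤ highEnd I v w f
    μw-before-f = ℚ.≤-trans (highEnd≤lowEnd μw≻f) (lowEnd≤highEnd w f)

  1≤above : ∀ {w w' f} → μ w' ≡ f → PrefF I f w' w → 1ℚ ≤ aboveSum I v w f
  1≤above {w} {w'} refl w'≻w = begin
    1ℚ                                         ≡⟨ highEnd+above≡1 (ℚ.<-≤-trans 0<θ (θ≤v w')) ⟨
    highEnd I v w' (μ w') + aboveSum I v w' (μ w') ≡⟨ cong (_+ aboveSum I v w' (μ w')) (highEnd-μ w') ⟩
    v w' (μ w') + aboveSum I v w' (μ w')       ≡⟨ ℚ.+-comm (v w' (μ w')) (aboveSum I v w' (μ w')) ⟩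
    aboveSum I v w' (μ w') + v w' (μ w')       ≤⟨ above+self≤above w'≻w ⟩
    aboveSum I v w (μ w')                      ∎
    where open ℚ.≤-Reasoning

  residual-cut : ∀ w f → belowSum I v w f + θ * aboveSum I P w f ≤ aboveSum I v w f + θ * belowSum I P w f
  residual-cut w f = subst₂ (λ a b → belowSum I v w f + θ * a ≤ aboveSum I v w f + θ * b)
                            (sym (aboveSum-P w f)) (sym (belowSum-P w f))
                            (cut (wRank I w f <ᶠ? wRank I w (μ w)) (fRank I f (partner f) <ᶠ? fRank I f w))
    where
    open ℚ.≤-Reasoning
    b a : ℚ
    b = belowSum I v w f
    a = aboveSum I v w f
    cut : (d₁ : Dec (PrefW I w f (μ w))) (d₂ : Dec (PrefF I f (partner f) w)) →
          b + θ * when ⌊ d₂ ⌋ 1ℚ ≤ a + θ * when ⌊ d₁ ⌋ 1ℚ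
    cut d₁            (no _)          = ℚ.+-mono-≤ (below≤above w f)
                                          (ℚ.*-monoˡ-≤-nonNeg θ {{nonNegative (ℚ.<⇒≤ 0<θ)}} (when-nonNeg ⌊ d₁ ⌋ 0≤1))
    cut (yes _)       (yes _)         = ℚ.+-monoˡ-≤ (θ * 1ℚ) (below≤above w f)
    cut (no f⊁μw)     (yes partner≻w) = begin
      b + θ * 1ℚ   ≡⟨ solve 2 (λ b θ → b :+ θ :* con 1ℚ := θ :+ b) refl b θ ⟩
      θ + b        ≤⟨ θ+below≤1 μw≻f ⟩
      1ℚ           ≤⟨ 1≤above (μ-partner f) partner≻w ⟩
      a            ≡⟨ solve 2 (λ a θ → a := a :+ θ :* con 0ℚ) refl a θ ⟩
      a + θ * 0ℚ   ∎
      where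
      μw≻f : PrefW I w (μ w) f
      μw≻f = ≯∧≢⇒< (Instance.wRankBij I w) f⊁μw
                   λ μw≡f → FP.<-irrefl (cong (fRank I f) (sym (partner-unique μw≡f))) partner≻w

  Z : Matrix n
  Z w f = c * (v w f - θ * P w f)

  c*[1-θ*1]≡1 : c * (1ℚ - θ * 1ℚ) ≡ 1ℚ
  c*[1-θ*1]≡1 = trans (solve 2 (λ c θ → c :* (con 1ℚ :- θ :* con 1ℚ) := (con 1ℚ :- θ) :* c) refl c θ) 1-θ*c≡1

  residual-nonNeg : ∀ w f → 0ℚ ≤ v w f - θ * P w f
  residual-nonNeg w f with μ w ≟ᶠ f
  ... | yes refl = 0≤q-p (subst (_≤ v w (μ w)) (sym (ℚ.*-identityʳ θ)) (θ≤v w))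
  ... | no _     = subst (0ℚ ≤_) (solve 2 (λ u θ → u := u :- θ :* con 0ℚ) refl (v w f) θ) (nonNeg w f)

  feasible-Z : FeasibleFor I Z
  feasible-Z = record
    { rowSum = λ w → trans (sumᶠ-affine c θ (v w) (P w))
                           (trans (cong₂ (λ s t → c * (s - θ * t)) (rowSum w) (rowSum-P w)) c*[1-θ*1]≡1)
    ; colSum = λ f → trans (sumᶠ-affine c θ (λ w → v w f) (λ w → P w f))
                           (trans (cong₂ (λ s t → c * (s - θ * t)) (colSum f) (colSum-P f)) c*[1-θ*1]≡1)
    ; below≤above = λ w f → subst₂ _≤_
        (sym (sumWhere-affine _ (λ f' → wRank I w f <ᶠ? wRank I w f') c θ (v w) (P w)))
        (sym (sumWhere-affine _ (λ w' → fRank I f w' <ᶠ? fRank I f w) c θ (λ w' → v w' f) (λ w' → P w' f)))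
        (ℚ.*-monoˡ-≤-nonNeg c {{nonNegative 0≤c}}
          (+-swap-≤ {belowSum I v w f} {aboveSum I v w f} (θ * belowSum I P w f) (θ * aboveSum I P w f) (residual-cut w f)))
    ; nonNeg = λ w f → *-nonNeg 0≤c (residual-nonNeg w f)
    }

  decomposition : ∀ w f → v w f ≡ θ * P w f + (1ℚ - θ) * Z w f
  decomposition w f = sym (begin
    θ * p + (1ℚ - θ) * (c * (u - θ * p))   ≡⟨ solve 4 (λ θ c u p → θ :* p :+ (con 1ℚ :- θ) :* (c :* (u :- θ :* p))
                                                           := θ :* p :+ ((con 1ℚ :- θ) :* c) :* (u :- θ :* p)) refl θ c u p ⟩
    θ * p + ((1ℚ - θ) * c) * (u - θ * p)   ≡⟨ cong (λ k → θ * p + k * (u - θ * p)) 1-θ*c≡1 ⟩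
    θ * p + 1ℚ * (u - θ * p)               ≡⟨ solve 3 (λ θ u p → θ :* p :+ con 1ℚ :* (u :- θ :* p) := u) refl θ u p ⟩
    u                                      ∎)
    where
    open ≡-Reasoning
    u p : ℚ
    u = v w f
    p = P w f

∃-smallThreshold : ∀ {n} {v : Matrix n} → (∀ w f → 0ℚ ≤ v w f) →
                   ∃ λ θ → 0ℚ < θ × θ < 1ℚ ×
                           ∀ I → NoEndpoint I v θ × (∀ {w f} → lowEnd I v w f ≤ θ → lowEnd I v w f ≡ 0ℚ)
∃-smallThreshold {v = v} v≥0 with ∃-positiveLowerBound₂ v
... | m , 0<m , m≤1 , m≼v with ℚ.<-dense 0<m
...   | θ , 0<θ , θ<m = θ , 0<θ , ℚ.<-≤-trans θ<m m≤1 , λ I →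
  noEndpoint I v≥0 m≼v 0<θ θ<m , lowEnd≤θ⇒≡0 I v≥0 m≼v 0<θ θ<m

vertex≡permutationMatrix : ∀ {n} {A B : Instance n} {v : Matrix n} {μ θ} →
                           IsVertex A B v → Stable A μ → Stable B μ → 0ℚ < θ → θ < 1ℚ →
                           (∀ w → InSubinterval A v θ w (μ w)) → (∀ w → InSubinterval B v θ w (μ w)) →
                           (∀ I {w f} → lowEnd I v w f ≤ θ → lowEnd I v w f ≡ 0ℚ) →
                           ∀ w f → v w f ≡ permutationMatrix μ w f
vertex≡permutationMatrix {n} {A} {B} {v} {μ} {θ} (feas , extreme) stableA stableB 0<θ θ<1 θ∈A θ∈B θ-small w f =
  begin
    v w f                              ≡⟨ DA.decomposition w f ⟩
    θ * P w f + (1ℚ - θ) * DA.Z w f    ≡⟨ cong (λ z → θ * P w f + (1ℚ - θ) * z) (P≡Z w f) ⟨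
    θ * P w f + (1ℚ - θ) * P w f       ≡⟨ solve 2 (λ θ p → θ :* p :+ (con 1ℚ :- θ) :* p := p) refl θ (P w f) ⟩
    P w f                              ∎
  where
  open ≡-Reasoning
  P : Matrix n
  P = permutationMatrix μ
  0<1-θ : 0ℚ < 1ℚ - θ
  0<1-θ = subst (_< 1ℚ - θ) (ℚ.+-inverseʳ θ) (ℚ.+-monoˡ-< (- θ) θ<1)
  instance
    1-θ≢0 : NonZero (1ℚ - θ)
    1-θ≢0 = ℚ.pos⇒nonZero (1ℚ - θ) {{positive 0<1-θ}}
  0≤c : 0ℚ ≤ 1/ (1ℚ - θ)
  0≤c = ℚ.<⇒≤ (ℚ.positive⁻¹ _ {{ℚ.1/pos⇒pos (1ℚ - θ) {{positive 0<1-θ}}}})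
  module DA = Decomposition (feasibleˡ {A = A} {B} feas) stableA 0<θ θ∈A (θ-small A) 0≤c (ℚ.*-inverseʳ (1ℚ - θ))
  module DB = Decomposition (feasibleʳ {A = A} {B} feas) stableB 0<θ θ∈B (θ-small B) 0≤c (ℚ.*-inverseʳ (1ℚ - θ))
  P≡Z : ∀ w f → P w f ≡ DA.Z w f
  P≡Z = extreme P DA.Z θ (feasible (PermutationMatrix.feasible-P A μ stableA) (PermutationMatrix.feasible-P B μ stableB))
                         (feasible DA.feasible-Z DB.feasible-Z) 0<θ θ<1 DA.decomposition

vertex⇒integral : ∀ {n} {A B : Instance n} {w₀} → (∀ w → w ≢ w₀ → SameList A B w) →
                  ∀ v → IsVertex A B v → Integral v
vertex⇒integral {A = A} {B} same v vertex@(feas , _) =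
  integral (feasibleˡ {A = A} {B} feas) (feasibleʳ {A = A} {B} feas)
  where
  integral : FeasibleFor A v → FeasibleFor B v → Integral v
  integral feasA feasB with ∃-smallThreshold (FeasibleFor.nonNeg feasA)
  ... | θ , 0<θ , θ<1 , small
    with stable-under-both same feasA feasB (ℚ.<⇒≤ 0<θ) (ℚ.<⇒≤ θ<1) (proj₁ (small A)) (proj₁ (small B))
  ... | μ , θ∈A , θ∈B , stableA , stableB = λ w f →
    let k , P≡k = permutationMatrix-integral μ w f
    in  k , trans (vertex≡permutationMatrix {A = A} {B} vertex stableA stableB 0<θ θ<1 θ∈A θ∈B
                                            (λ I → proj₂ (small I)) w f)
                  P≡k

corollary3 : ∀ (n : ℕ) (A B : Instance n) →
    (∃ λ (w₀ : Fin n) → ∀ w → w ≢ w₀ → SameList A B w) →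
    (∀ (x : Fin n → Fin n → ℚ) → Feasible A B x →
      ∀ (θ : ℚ) → 0ℚ ≤ θ → θ ≤ 1ℚ → NoEndpoint A x θ → NoEndpoint B x θ →
      ∃ λ (μ : Fin n → Fin n) →
        (∀ w → InSubinterval A x θ w (μ w)) ×
        (∀ w → InSubinterval B x θ w (μ w)) ×
        Stable A μ × Stable B μ)
    × (∀ (v : Fin n → Fin n → ℚ) → IsVertex A B v → Integral v)
corollary3 n A B (w₀ , same) =
  (λ x feas θ → stable-under-both same (feasibleˡ {A = A} {B} feas) (feasibleʳ {A = A} {B} feas) {θ}) ,
  vertex⇒integral {A = A} {B} same
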